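{- Let $D$ be a defeasible theory and $S_D$ its compiled program. Let $\mathcal P$ be the set of predicates of $S_D$, let $\mathcal F$ be the set of predicates of $S_D$ of the forms $\mathtt{definitely\_q}$, $\mathtt{body}^\Delta_r$, $\mathtt{lambda\_q}$ and $\mathtt{body}^\lambda_r$, and let $\mathcal Q=\mathcal P\setminus\mathcal F$. Then (a) $\mathcal P$ is downward-closed with floor $\mathcal F$; (b) $\mathcal Q$ has a signing $s$ in which every predicate of the form $\mathtt{defeasibly\_q}$ is assigned $+1$; and (c) for every predicate $q$ of $D$, the predicate $\mathtt{defeasibly\_q}$ avoids negative unfoundedness with respect to $s$.
   Context: Defeasible theories. A literal is an atom $p(t_1,\dots,t_n)$ or its classical negation; ${\sim}q$ is the complementary literal. A defeasible theory $D=(F,R,>)$ consists of a finite set $F$ of variable-free literals (facts), a finite set $R$ of labelled rules $r$ with finite antecedent set $A(r)$, consequent $C(r)$ and kind strict ($\to$), defeasible ($\Rightarrow$) or defeater ($\leadsto$), and an acyclic superiority relation $>$ on labels. Compiled program. For a literal $q$ with predicate $p$, $\mathtt{q}$ denotes $\mathtt{p}$ if $q$ is positive and $\mathtt{not\_p}$ if negative; $\mathtt{{\sim}q}$ is the name of the complement; predicate names are formed by concatenation; rule labels are constants. $S_D$ consists exactly of: (i) for each fact $q(\vec a)$: unit clauses $\mathtt{definitely\_q}(\vec a)$, $\mathtt{lambda\_q}(\vec a)$, $\mathtt{defeasibly\_q}(\vec a)$; (ii) for each strict rule $r:q_1(\vec a_1),\dots,q_n(\vec a_n)\to q(\vec a)$: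 $\mathtt{definitely\_q}(\vec a)\,\text{:- }\,\mathtt{body}^\Delta_r(\vec a)$, $\mathtt{lambda\_q}(\vec a)\,\text{:- }\,\mathtt{body}^\Delta_r(\vec a)$, $\mathtt{defeasibly\_q}(\vec a)\,\text{:- }\,\mathtt{body}^\Delta_r(\vec a)$, $\mathtt{body}^\Delta_r(\vec a)\,\text{:- }\,\mathtt{definitely\_q_1}(\vec a_1),\dots,\mathtt{definitely\_q_n}(\vec a_n)$; (iii) for each strict or defeasible rule $r:q_1(\vec a_1),\dots,q_n(\vec a_n)\hookrightarrow q(\vec a)$: $\mathtt{lambda\_q}(\vec a)\,\text{:- }\,not\ \mathtt{definitely\_{\sim}q}(\vec a),\mathtt{body}^\lambda_r(\vec a)$ and $\mathtt{defeasibly\_q}(\vec a)\,\text{:- }\,not\ \mathtt{definitely\_{\sim}q}(\vec a),\mathtt{body}^d_r(\vec a),not\ \mathtt{overruled\_q}(\vec a)$; (iv) for each rule $s$ of any kind, $s:q_1(\vec a_1),\dots,q_n(\vec a_n)\hookrightarrow q(\vec a)$: $\mathtt{body}^\lambda_s(\vec a)\,\text{:- }\,\mathtt{lambda\_q_1}(\vec a_1),\dots,\mathtt{lambda\_q_n}(\vec a_n)$, $\mathtt{body}^d_s(\vec a)\,\text{:- }\,\mathtt{defeasibly\_q_1}(\vec a_1),\dots,\mathtt{defeasibly\_q_n}(\vec a_n)$, $\mathtt{overruled\_{\sim}q}(\vec a)\,\text{:- }\,\mathtt{body}^\lambda_s(\vec a),not\ \mathtt{defeated\_q}(s,\vec a)$;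 (v) for each strict or defeasible rule $t$ with consequent $q(\vec a)$ and each rule $s$ with consequent of the form ${\sim}q(\dots)$ with $t>s$: $\mathtt{defeated\_{\sim}q}(s,\vec a)\,\text{:- }\,\mathtt{body}^d_t(\vec a)$. Dependencies. For predicates of a program, $p\sqsupseteq_{+1}q$ ($p\sqsupseteq_{ -1}q$) if some clause has head predicate $p$ and a positive (negative) body literal with predicate $q$; $p\sqsupseteq q$ if either holds; $\geq$ is the transitive closure of $\sqsupseteq$ ($p$ depends on $q$ if $p\geq q$), and $q\leq p$ means $p\geq q$. $\geq_{+1},\geq_{ -1}$ are the least relations with $p\geq_{+1}p$ and ($p\sqsupseteq_i q$, $q\geq_j r$ imply $p\geq_{i\cdot j}r$); $q\leq_i p$ means $p\geq_i q$. A set $\mathcal P$ of predicates is downward-closed if $p\in\mathcal P$ and $q\leq p$ imply $q\in\mathcal P$; it is downward-closed with floor $\mathcal F$ if $\mathcal F\subset\mathcal P$ and both are downward-closed. A signing for a set $\mathcal Q$ is a function $s$ from predicates to $\{ -1,+1\}$ such that for $p,q\in\mathcal Q$, $p\leq_i q$ implies $s(p)=s(q)\cdot i$. An infinite sequence of atoms $q_1(\vec a_1),q_2(\vec a_2),\dots$ is unfounded with respect to $\mathcal Q$ if $q_i\sqsupseteq_{+1}q_{i+1}$ and $q_i\in\mathcal Q$ for all $i$. A predicate $p$ avoids negative unfoundedness with respect to a signing $s$ on $\mathcal Q$ if for every predicate $q$ with $s(q)=-1$ on which $p$ depends, no $q$-atom starts a sequence that is unfounded with respect to $\mathcal Q$.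 -}

module Defs where

open import Data.Nat using (ℕ; suc)
open import Data.Sign using (Sign; +; -; _*_)
open import Data.Product using (Σ; _×_; _,_; ∃; proj₁; proj₂)
open import Data.Sum using (_⊎_)
open import Data.List using (List; []; _∷_; map)
open import Data.List.Membership.Propositional using (_∈_)
open import Data.List.Relation.Unary.Any using (Any)
open import Relation.Binary.PropositionalEquality using (_≡_)
open import Relation.Binary.Construct.Closure.Transitive using (TransClosure)
open import Relation.Nullary using (¬_)
open import Data.Unit using (⊤)
open import Data.Empty using (⊥)

record Vocabulary : Set₁ where
  field
    Pred  : Set
    Var   : Set
    Const : Set
    Label : Set

module _ {V : Vocabulary} where
  open Vocabulary V

  data Term : Set where
    var   : Var → Term
    const : Const → Term

  -- literal: atom-predicate p or its classical negation ~p
  data Lit : Set where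
    pos : Pred → Lit
    neg : Pred → Lit

  ∼_ : Lit → Lit
  ∼ pos p = neg p
  ∼ neg p = pos p

  data Kind : Set where
    strict defeasible defeater : Kind

  record LAtom : Set where
    constructor _⟨_⟩
    field
      lit  : Lit
      args : List Term
  open LAtom public

  record Rule : Set where
    field
      label : Label
      kind  : Kind
      ante  : List LAtom
      cons  : LAtom
  open Rule public

  record GLit : Set where
    constructor _⟨_⟩g
    field
      glit  : Lit
      gargs : List Const
  open GLit public

  record Theory : Set where
    field
      facts : List GLit
      rules : List Rule
      sup   : List (Label × Label)   -- (t , s) ∈ sup  means  t > s
  open Theory public

  _≻[_]_ : Label → Theory → Label → Set
  t ≻[ D ] s = (t , s) ∈ sup D

  Acyclic : Theory → Set
  Acyclic D = ∀ l → ¬ TransClosure (λ t s → t ≻[ D ] s) l l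

  data CPred : Set where
    definitely lambda defeasibly overruled defeated : Lit → CPred
    bodyΔ bodyλ bodyd : Label → CPred

  data CTerm : Set where
    term : Term → CTerm
    lab  : Label → CTerm

  infix 25 _⦅_⦆
  infix 20 _:-_
  infix 25 _⟨_⟩
  infix 25 _⟨_⟩g
  record Atom : Set where
    constructor _⦅_⦆
    field
      pred  : CPred
      cargs : List CTerm
  open Atom public

  data BLit : Set where
    ⁺ : Atom → BLit
    ⁻ : Atom → BLit   -- negative body literal  not a

  record Clause : Set where
    constructor _:-_
    field
      head : Atom
      body : List BLit
  open Clause public

  targs : List Term → List CTerm
  targs = map term

  cAtom : (Lit → CPred) → LAtom → Atom
  cAtom f (q ⟨ a ⟩) = f q ⦅ targs a ⦆

  data _∈S[_] : Clause → Theory → Set where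
    fact-def : ∀ {D q cs} → (q ⟨ cs ⟩g) ∈ facts D →
      (definitely q ⦅ map (λ c → term (const c)) cs ⦆ :- []) ∈S[ D ]
    fact-lam : ∀ {D q cs} → (q ⟨ cs ⟩g) ∈ facts D →
      (lambda q ⦅ map (λ c → term (const c)) cs ⦆ :- []) ∈S[ D ]
    fact-dfs : ∀ {D q cs} → (q ⟨ cs ⟩g) ∈ facts D →
      (defeasibly q ⦅ map (λ c → term (const c)) cs ⦆ :- []) ∈S[ D ]
    str-def : ∀ {D} r → r ∈ rules D → kind r ≡ strict →
      (cAtom definitely (cons r) :- (⁺ (bodyΔ (label r) ⦅ targs (args (cons r)) ⦆) ∷ [])) ∈S[ D ]
    str-lam : ∀ {D} r → r ∈ rules D → kind r ≡ strict →
      (cAtom lambda (cons r) :- (⁺ (bodyΔ (label r) ⦅ targs (args (cons r)) ⦆) ∷ [])) ∈S[ D ]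
    str-dfs : ∀ {D} r → r ∈ rules D → kind r ≡ strict →
      (cAtom defeasibly (cons r) :- (⁺ (bodyΔ (label r) ⦅ targs (args (cons r)) ⦆) ∷ [])) ∈S[ D ]
    str-body : ∀ {D} r → r ∈ rules D → kind r ≡ strict →
      ((bodyΔ (label r) ⦅ targs (args (cons r)) ⦆) :- map (λ a → ⁺ (cAtom definitely a)) (ante r)) ∈S[ D ]
    sd-lam : ∀ {D} r → r ∈ rules D → ¬ kind r ≡ defeater →
      (cAtom lambda (cons r) :-
         (⁻ (definitely (∼ lit (cons r)) ⦅ targs (args (cons r)) ⦆)
          ∷ ⁺ (bodyλ (label r) ⦅ targs (args (cons r)) ⦆) ∷ [])) ∈S[ D ]
    sd-dfs : ∀ {D} r → r ∈ rules D → ¬ kind r ≡ defeater →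
      (cAtom defeasibly (cons r) :-
         (⁻ (definitely (∼ lit (cons r)) ⦅ targs (args (cons r)) ⦆)
          ∷ ⁺ (bodyd (label r) ⦅ targs (args (cons r)) ⦆)
          ∷ ⁻ (overruled (lit (cons r)) ⦅ targs (args (cons r)) ⦆) ∷ [])) ∈S[ D ]
    any-bλ : ∀ {D} s → s ∈ rules D →
      ((bodyλ (label s) ⦅ targs (args (cons s)) ⦆) :- map (λ a → ⁺ (cAtom lambda a)) (ante s)) ∈S[ D ]
    any-bd : ∀ {D} s → s ∈ rules D →
      ((bodyd (label s) ⦅ targs (args (cons s)) ⦆) :- map (λ a → ⁺ (cAtom defeasibly a)) (ante s)) ∈S[ D ]
    any-ovr : ∀ {D} s → s ∈ rules D →
      ((overruled (∼ lit (cons s)) ⦅ targs (args (cons s)) ⦆) :-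
         (⁺ (bodyλ (label s) ⦅ targs (args (cons s)) ⦆)
          ∷ ⁻ (defeated (lit (cons s)) ⦅ lab (label s) ∷ targs (args (cons s)) ⦆) ∷ [])) ∈S[ D ]
    sup-dft : ∀ {D} t s → t ∈ rules D → s ∈ rules D → ¬ kind t ≡ defeater →
      lit (cons s) ≡ ∼ lit (cons t) → label t ≻[ D ] label s →
      ((defeated (∼ lit (cons t)) ⦅ lab (label s) ∷ targs (args (cons t)) ⦆) :-
         (⁺ (bodyd (label t) ⦅ targs (args (cons t)) ⦆) ∷ [])) ∈S[ D ]

  blPred : BLit → CPred
  blPred (⁺ a) = pred a
  blPred (⁻ a) = pred a

  PredsOf : Theory → CPred → Set
  PredsOf D p = ∃ λ c → c ∈S[ D ] ×
                  (p ≡ pred (head c) ⊎ Any (λ l → p ≡ blPred l) (body c))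

  sgnLit : Sign → Atom → BLit
  sgnLit + a = ⁺ a
  sgnLit - a = ⁻ a

  Dep : Theory → CPred → Sign → CPred → Set
  Dep D p i q = ∃ λ c → c ∈S[ D ] × pred (head c) ≡ p ×
                  ∃ λ as → sgnLit i (q ⦅ as ⦆) ∈ body c

  Dep? : Theory → CPred → CPred → Set
  Dep? D p q = Dep D p + q ⊎ Dep D p - q

  DependsOn : Theory → CPred → CPred → Set
  DependsOn D = TransClosure (Dep? D)

  data DepSgn (D : Theory) : CPred → Sign → CPred → Set where
    refl⁺ : ∀ {p} → DepSgn D p + p
    step  : ∀ {p q r i j} → Dep D p i q → DepSgn D q j r → DepSgn D p (i * j) r

  PSet : Set₁
  PSet = CPred → Set

  _⊆_ : PSet → PSet → Set
  A ⊆ B = ∀ p → A p → B p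

  DownwardClosed : Theory → PSet → Set
  DownwardClosed D 𝒫 = ∀ p q → 𝒫 p → DependsOn D p q → 𝒫 q

  DownwardClosedWithFloor : Theory → PSet → PSet → Set
  DownwardClosedWithFloor D 𝒫 ℱ = ℱ ⊆ 𝒫 × DownwardClosed D ℱ × DownwardClosed D 𝒫

  Signing : Theory → PSet → (CPred → Sign) → Set
  Signing D 𝒬 s = ∀ p q i → 𝒬 p → 𝒬 q → DepSgn D q i p → s p ≡ s q * i

  Unfounded : Theory → PSet → (ℕ → Atom) → Set
  Unfounded D 𝒬 σ = ∀ n → Dep D (pred (σ n)) + (pred (σ (suc n))) × 𝒬 (pred (σ n))

  AvoidsNegUnfounded : Theory → PSet → (CPred → Sign) → CPred → Set
  AvoidsNegUnfounded D 𝒬 s p =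
    ∀ q → s q ≡ - → DependsOn D p q →
      ∀ (σ : ℕ → Atom) → pred (σ 0) ≡ q → ¬ Unfounded D 𝒬 σ

  FloorForm : CPred → Set
  FloorForm (definitely _) = ⊤
  FloorForm (lambda _)     = ⊤
  FloorForm (bodyΔ _)      = ⊤
  FloorForm (bodyλ _)      = ⊤
  FloorForm _              = ⊥

  𝓟 : Theory → PSet
  𝓟 D = PredsOf D

  𝓕 : Theory → PSet
  𝓕 D p = PredsOf D p × FloorForm p

  𝓠 : Theory → PSet
  𝓠 D p = PredsOf D p × ¬ FloorForm p

{-# OPTIONS --safe #-}
-- Every dependency p ⊒ᵢ q of S_D is one of fourteen edges between predicate
-- shapes, whatever D is. Along these edges the floor shapes (definitely,
-- lambda, bodyΔ, bodyλ) lead only to floor shapes, which gives (a). Among the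
-- remaining shapes the only negative edges are defeasibly ⊒ overruled and
-- overruled ⊒ defeated, so giving overruled the sign − and every other shape
-- + is a signing, which gives (b). The only positive edge out of overruled
-- goes to bodyλ, which is in the floor, so no sequence unfounded w.r.t. 𝒬
-- even starts at a negatively signed predicate, which gives (c).
module Submission where

open import Defs
open import Data.Product using (Σ; _×_; _,_; proj₁; proj₂; ∃)
open import Data.Sign using (Sign; +; -; _*_)
open import Data.Sign.Properties using (*-identityʳ; *-assoc)
open import Data.Sum using (inj₁; inj₂)
open import Data.List using (List; map)
import Data.List.Relation.Unary.Any as Any
open import Data.List.Relation.Unary.Any using (here; there)
open import Data.List.Membership.Propositional using (_∈_)
open import Data.List.Membership.Propositional.Properties using (∈-map⁻)
open import Relation.Binary.PropositionalEquality using (_≡_; refl; sym; trans; cong)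
open import Relation.Binary.Construct.Closure.Transitive using ([_]; _∷_)
open import Relation.Nullary using (¬_)
open import Data.Unit using (tt)
open import Data.Empty using (⊥-elim)

module _ {V : Vocabulary} where

  data ShapeDep : CPred {V} → Sign → CPred {V} → Set where
    definitely⊒bodyΔ         : ∀ {q r} → ShapeDep (definitely q) + (bodyΔ r)
    lambda⊒bodyΔ             : ∀ {q r} → ShapeDep (lambda q) + (bodyΔ r)
    defeasibly⊒bodyΔ         : ∀ {q r} → ShapeDep (defeasibly q) + (bodyΔ r)
    bodyΔ⊒definitely         : ∀ {q r} → ShapeDep (bodyΔ r) + (definitely q)
    lambda⊒¬definitely       : ∀ {q q′} → ShapeDep (lambda q) - (definitely q′)
    lambda⊒bodyλ             : ∀ {q r} → ShapeDep (lambda q) + (bodyλ r)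
    defeasibly⊒¬definitely   : ∀ {q q′} → ShapeDep (defeasibly q) - (definitely q′)
    defeasibly⊒bodyd         : ∀ {q r} → ShapeDep (defeasibly q) + (bodyd r)
    defeasibly⊒¬overruled    : ∀ {q q′} → ShapeDep (defeasibly q) - (overruled q′)
    bodyλ⊒lambda             : ∀ {q r} → ShapeDep (bodyλ r) + (lambda q)
    bodyd⊒defeasibly         : ∀ {q r} → ShapeDep (bodyd r) + (defeasibly q)
    overruled⊒bodyλ          : ∀ {q r} → ShapeDep (overruled q) + (bodyλ r)
    overruled⊒¬defeated      : ∀ {q q′} → ShapeDep (overruled q) - (defeated q′)
    defeated⊒bodyd           : ∀ {q r} → ShapeDep (defeated q) + (bodyd r)

  ∈-positiveBody : ∀ (f : Lit {V} → CPred {V}) {i q as} (xs : List (LAtom {V})) →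
    sgnLit i (q ⦅ as ⦆) ∈ map (λ a → ⁺ (cAtom f a)) xs → i ≡ + × ∃ λ l → q ≡ f l
  ∈-positiveBody f xs m with ∈-map⁻ (λ a → ⁺ (cAtom f a)) m
  ∈-positiveBody f {i = +} xs m | a , _ , refl = refl , lit a , refl
  ∈-positiveBody f {i = - } xs m | a , _ , ()

  clause-shapeDep : ∀ {D : Theory {V}} {c} → c ∈S[ D ] →
    ∀ i {q as} → sgnLit i (q ⦅ as ⦆) ∈ body c → ShapeDep (pred (head c)) i q
  clause-shapeDep (fact-def _) _ ()
  clause-shapeDep (fact-lam _) _ ()
  clause-shapeDep (fact-dfs _) _ ()
  clause-shapeDep (str-def _ _ _) + (here refl) = definitely⊒bodyΔ
  clause-shapeDep (str-def _ _ _) - (here ())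
  clause-shapeDep (str-def _ _ _) _ (there ())
  clause-shapeDep (str-lam _ _ _) + (here refl) = lambda⊒bodyΔ
  clause-shapeDep (str-lam _ _ _) - (here ())
  clause-shapeDep (str-lam _ _ _) _ (there ())
  clause-shapeDep (str-dfs _ _ _) + (here refl) = defeasibly⊒bodyΔ
  clause-shapeDep (str-dfs _ _ _) - (here ())
  clause-shapeDep (str-dfs _ _ _) _ (there ())
  clause-shapeDep (str-body r _ _) _ m with ∈-positiveBody definitely (ante r) m
  ... | refl , _ , refl = bodyΔ⊒definitely
  clause-shapeDep (sd-lam _ _ _) - (here refl) = lambda⊒¬definitely
  clause-shapeDep (sd-lam _ _ _) + (here ())
  clause-shapeDep (sd-lam _ _ _) + (there (here refl)) = lambda⊒bodyλ
  clause-shapeDep (sd-lam _ _ _) - (there (here ()))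
  clause-shapeDep (sd-lam _ _ _) _ (there (there ()))
  clause-shapeDep (sd-dfs _ _ _) - (here refl) = defeasibly⊒¬definitely
  clause-shapeDep (sd-dfs _ _ _) + (here ())
  clause-shapeDep (sd-dfs _ _ _) + (there (here refl)) = defeasibly⊒bodyd
  clause-shapeDep (sd-dfs _ _ _) - (there (here ()))
  clause-shapeDep (sd-dfs _ _ _) - (there (there (here refl))) = defeasibly⊒¬overruled
  clause-shapeDep (sd-dfs _ _ _) + (there (there (here ())))
  clause-shapeDep (sd-dfs _ _ _) _ (there (there (there ())))
  clause-shapeDep (any-bλ s _) _ m with ∈-positiveBody lambda (ante s) m
  ... | refl , _ , refl = bodyλ⊒lambda
  clause-shapeDep (any-bd s _) _ m with ∈-positiveBody defeasibly (ante s) m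
  ... | refl , _ , refl = bodyd⊒defeasibly
  clause-shapeDep (any-ovr _ _) + (here refl) = overruled⊒bodyλ
  clause-shapeDep (any-ovr _ _) - (here ())
  clause-shapeDep (any-ovr _ _) - (there (here refl)) = overruled⊒¬defeated
  clause-shapeDep (any-ovr _ _) + (there (here ()))
  clause-shapeDep (any-ovr _ _) _ (there (there ()))
  clause-shapeDep (sup-dft _ _ _ _ _ _ _) + (here refl) = defeated⊒bodyd
  clause-shapeDep (sup-dft _ _ _ _ _ _ _) - (here ())
  clause-shapeDep (sup-dft _ _ _ _ _ _ _) _ (there ())

  Dep⇒ShapeDep : ∀ {D : Theory {V}} {p i q} → Dep D p i q → ShapeDep p i q
  Dep⇒ShapeDep {i = i} (_ , c∈S , refl , _ , m) = clause-shapeDep c∈S i m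

  Dep?⇒ShapeDep : ∀ {D : Theory {V}} {p q} → Dep? D p q → ∃ λ i → ShapeDep p i q
  Dep?⇒ShapeDep (inj₁ d) = + , Dep⇒ShapeDep d
  Dep?⇒ShapeDep (inj₂ d) = - , Dep⇒ShapeDep d

  ShapeDep-floor : ∀ {p i q} → ShapeDep p i q → FloorForm p → FloorForm q
  ShapeDep-floor definitely⊒bodyΔ _ = tt
  ShapeDep-floor lambda⊒bodyΔ     _ = tt
  ShapeDep-floor bodyΔ⊒definitely _ = tt
  ShapeDep-floor lambda⊒¬definitely _ = tt
  ShapeDep-floor lambda⊒bodyλ     _ = tt
  ShapeDep-floor bodyλ⊒lambda     _ = tt

  sign : CPred {V} → Sign
  sign (overruled _) = -
  sign _             = +

  ShapeDep-sign : ∀ {p i q} → ShapeDep p i q → ¬ FloorForm q → sign q ≡ sign p * i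
  ShapeDep-sign defeasibly⊒bodyd      _ = refl
  ShapeDep-sign defeasibly⊒¬overruled _ = refl
  ShapeDep-sign bodyd⊒defeasibly      _ = refl
  ShapeDep-sign overruled⊒¬defeated   _ = refl
  ShapeDep-sign defeated⊒bodyd        _ = refl
  ShapeDep-sign definitely⊒bodyΔ       q∉ℱ = ⊥-elim (q∉ℱ tt)
  ShapeDep-sign lambda⊒bodyΔ           q∉ℱ = ⊥-elim (q∉ℱ tt)
  ShapeDep-sign defeasibly⊒bodyΔ       q∉ℱ = ⊥-elim (q∉ℱ tt)
  ShapeDep-sign bodyΔ⊒definitely       q∉ℱ = ⊥-elim (q∉ℱ tt)
  ShapeDep-sign lambda⊒¬definitely     q∉ℱ = ⊥-elim (q∉ℱ tt)
  ShapeDep-sign lambda⊒bodyλ           q∉ℱ = ⊥-elim (q∉ℱ tt)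
  ShapeDep-sign defeasibly⊒¬definitely q∉ℱ = ⊥-elim (q∉ℱ tt)
  ShapeDep-sign bodyλ⊒lambda           q∉ℱ = ⊥-elim (q∉ℱ tt)
  ShapeDep-sign overruled⊒bodyλ        q∉ℱ = ⊥-elim (q∉ℱ tt)

  overruled⊒⁺-floor : ∀ {q p} → ShapeDep (overruled q) + p → FloorForm p
  overruled⊒⁺-floor overruled⊒bodyλ = tt

  blPred-sgnLit : ∀ i (a : Atom {V}) → blPred (sgnLit i a) ≡ pred a
  blPred-sgnLit + a = refl
  blPred-sgnLit - a = refl

  Dep-predOf : ∀ {D : Theory {V}} {p i q} → Dep D p i q → PredsOf D q
  Dep-predOf {i = i} (c , c∈S , _ , _ , m) =
    c , c∈S , inj₂ (Any.map (λ eq → trans (sym (blPred-sgnLit i _)) (cong blPred eq)) m)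

  DependsOn-predOf : ∀ {D : Theory {V}} {p q} → DependsOn D p q → PredsOf D q
  DependsOn-predOf [ inj₁ d ] = Dep-predOf d
  DependsOn-predOf [ inj₂ d ] = Dep-predOf d
  DependsOn-predOf (_ ∷ ds)   = DependsOn-predOf ds

  DependsOn-floor : ∀ {D : Theory {V}} {p q} → DependsOn D p q → FloorForm p → FloorForm q
  DependsOn-floor [ d ]    p∈ℱ = ShapeDep-floor (proj₂ (Dep?⇒ShapeDep d)) p∈ℱ
  DependsOn-floor (d ∷ ds) p∈ℱ = DependsOn-floor ds (ShapeDep-floor (proj₂ (Dep?⇒ShapeDep d)) p∈ℱ)

  DepSgn-floor : ∀ {D : Theory {V}} {p i q} → DepSgn D p i q → FloorForm p → FloorForm q
  DepSgn-floor refl⁺       p∈ℱ = p∈ℱ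
  DepSgn-floor (step d ds) p∈ℱ = DepSgn-floor ds (ShapeDep-floor (Dep⇒ShapeDep d) p∈ℱ)

  -- The intermediate predicates of a path into 𝒬 lie outside the floor,
  -- because the floor is closed under dependency.
  DepSgn-sign : ∀ {D : Theory {V}} {q i p} → DepSgn D q i p → ¬ FloorForm p →
    sign p ≡ sign q * i
  DepSgn-sign {q = q} refl⁺ _ = sym (*-identityʳ (sign q))
  DepSgn-sign {q = q} (step {i = i} {j = j} d ds) p∉ℱ = trans (DepSgn-sign ds p∉ℱ)
    (trans (cong (_* j) (ShapeDep-sign (Dep⇒ShapeDep d) (λ r∈ℱ → p∉ℱ (DepSgn-floor ds r∈ℱ))))
           (*-assoc (sign q) i j))

  𝓟-downwardClosedWithFloor : ∀ (D : Theory {V}) → DownwardClosedWithFloor D (𝓟 D) (𝓕 D)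
  𝓟-downwardClosedWithFloor D =
      (λ _ → proj₁)
    , (λ _ _ p∈ℱ d → DependsOn-predOf d , DependsOn-floor d (proj₂ p∈ℱ))
    , (λ _ _ _ d → DependsOn-predOf d)

  sign-signing : ∀ (D : Theory {V}) → Signing D (𝓠 D) sign
  sign-signing D _ _ _ p∈𝒬 _ d = DepSgn-sign d (proj₂ p∈𝒬)

  sign-avoidsNegUnfounded : ∀ (D : Theory {V}) p → AvoidsNegUnfounded D (𝓠 D) sign p
  sign-avoidsNegUnfounded D _ (overruled _) refl _ σ σ₀≡q unfounded
    with unfounded 0 | unfounded 1
  ... | σ₀⊒σ₁ , _ | _ , (_ , σ₁∉ℱ) rewrite σ₀≡q =
    σ₁∉ℱ (overruled⊒⁺-floor (Dep⇒ShapeDep σ₀⊒σ₁))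

theorem9 : (V : Vocabulary) (D : Theory {V}) → Acyclic D →
    DownwardClosedWithFloor D (𝓟 D) (𝓕 D)
    × Σ (CPred {V} → Sign) (λ s →
    Signing D (𝓠 D) s
    × (∀ q → s (defeasibly q) ≡ +)
    × (∀ q → AvoidsNegUnfounded D (𝓠 D) s (defeasibly q)))
theorem9 V D _ =
    𝓟-downwardClosedWithFloor D
  , sign
  , sign-signing D
  , (λ _ → refl)
  , (λ q → sign-avoidsNegUnfounded D (defeasibly q))
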